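{- Let $a$ be a positive integer and define the linear operator $RM_a^{(1)} = \sum_{i\geq 0} (-1)^i m_{(a+i)}\, e_{i}^\perp$ on symmetric functions. Then for every partition $\lambda$, $$RM_a^{(1)} m_\lambda = (1 + n_a(\lambda))\, m_{\lambda + (a)}.$$
   Context: $m_\lambda$ are the monomial symmetric functions (acting by multiplication), $e_i$ the elementary symmetric functions with $e_0=1$; $g^\perp$ denotes the adjoint of multiplication by $g$ with respect to the Hall inner product (so $e_0^\perp$ is the identity). $n_a(\lambda)$ is the number of parts of $\lambda$ equal to $a$, and $\lambda+(a)$ is the partition obtained by inserting a part equal to $a$ into $\lambda$. -}

module Defs where

open import Data.Nat using (ℕ; zero; suc; _+_; _∸_; _≤ᵇ_; _≡ᵇ_; _⊔_; _⊓_; _≥_; _≤_)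
import Data.Nat as ℕ
open import Data.Integer as ℤ using (ℤ; +_; -_; _*_)
open import Data.Nat.ListAction using (sum)
open import Data.List using (List; []; _∷_; map; foldr; concat; concatMap; zipWith; filter; length; upTo; applyUpTo; _++_)
open import Data.List.Properties using (≡-dec)
open import Data.List.Relation.Unary.All using (All)
open import Data.List.Relation.Unary.Linked using (Linked)
open import Data.Product using (_×_; _,_; proj₁; proj₂)
open import Data.Bool using (if_then_else_)
open import Relation.Nullary.Decidable using (does; _×-dec_)
open import Relation.Binary.PropositionalEquality using (_≡_)
open import Relation.Binary using (DecidableEquality)

IsPartition : List ℕ → Set
IsPartition λ′ = All (λ x → 1 ≤ x) λ′ × Linked _≥_ λ′

_≟L_ : DecidableEquality (List ℕ)
_≟L_ = ≡-dec ℕ._≟_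

insD : ℕ → List ℕ → List ℕ
insD x []       = x ∷ []
insD x (y ∷ ys) = if y ≤ᵇ x then x ∷ y ∷ ys else y ∷ insD x ys

-- the partition underlying an exponent vector / multiset:
-- drop zeros, sort weakly decreasingly
sortP : List ℕ → List ℕ
sortP = foldr (λ x acc → if x ≡ᵇ 0 then acc else insD x acc) []

_⊕_ : List ℕ → ℕ → List ℕ
λ′ ⊕ a = sortP (a ∷ λ′)

nPart : ℕ → List ℕ → ℕ
nPart a λ′ = length (filter (λ x → a ℕ.≟ x) λ′)

-- all partitions of n (fuel, size, max part)
parts : ℕ → ℕ → ℕ → List (List ℕ)
parts _        zero    _ = [] ∷ []
parts zero     (suc n) _ = []
parts (suc f)  (suc n) m =
  concatMap (λ k → map (k ∷_) (parts f (suc n ∸ k) k)) (applyUpTo suc (suc n ⊓ m))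

partitions : ℕ → List (List ℕ)
partitions n = parts n n n

sumℤ : List ℤ → ℤ
sumℤ = foldr ℤ._+_ (+ 0)

sign : ℕ → ℤ
sign zero    = + 1
sign (suc i) = - sign i

-- Symmetric functions, written in the monomial basis: an element f is
-- given by its coefficient function  μ ↦ [m_μ] f  (only evaluated at
-- partitions; all operators below use finite sums).

SF : Set
SF = List ℕ → ℤ

mono : List ℕ → SF
mono λ′ ν = if does (ν ≟L λ′) then + 1 else + 0

box : List ℕ → List (List ℕ)
box []       = [] ∷ []
box (l ∷ ls) = concatMap (λ j → map (j ∷_) (box ls)) (upTo (suc l))

-- [m_λ](m_μ m_ν) = coefficient of x^λ in m_μ m_ν
--   = #{ α + β = λ : α a monomial of m_μ, β a monomial of m_ν }
mulCoeff : List ℕ → List ℕ → List ℕ → ℕ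
mulCoeff μ ν λ′ =
  length (filter (λ α → (sortP α ≟L μ) ×-dec (sortP (zipWith _∸_ λ′ α) ≟L ν)) (box λ′))

-- multiplication by m_(k):  [m_λ](m_(k) f) = Σ_μ [m_μ]f · [m_λ](m_(k) m_μ)
-- (only μ ⊢ |λ| - k contribute, by degree)
mulM : ℕ → SF → SF
mulM k f λ′ = sumℤ (map (λ μ → f μ * + mulCoeff (k ∷ []) μ λ′) (partitions (sum λ′ ∸ k)))

-- Expansion of e_0, …, e_n in the basis h_μ (Λ = ℤ[h_1,h_2,…]) via the
-- defining relation Σ_{r=0}^{k} (-1)^r h_r e_{k-r} = 0 (k ≥ 1), e_0 = 1, i.e.
-- e_k = Σ_{r=1}^{k} (-1)^{r-1} h_r e_{k-r}.   es n = [e_n, e_{n-1}, …, e_0].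
es : ℕ → List (List (ℤ × List ℕ))
es zero    = ((+ 1 , []) ∷ []) ∷ []
es (suc n) =
  concat (zipWith (λ r t → map (λ p → (sign (r ∸ 1) * proj₁ p , sortP (r ∷ proj₂ p))) t)
                  (applyUpTo suc (suc n)) (es n))
  ∷ es n

eExp : ℕ → List (ℤ × List ℕ)
eExp n with es n
... | []    = []
... | t ∷ _ = t

eh : ℕ → List ℕ → ℤ
eh i μ = sumℤ (map proj₁ (filter (λ p → proj₂ p ≟L μ) (eExp i)))

-- e_i^⊥, the adjoint of multiplication by e_i for the Hall inner product
-- (⟨m_λ , h_μ⟩ = δ_{λμ}):
--   [m_ν](e_i^⊥ f) = ⟨e_i^⊥ f , h_ν⟩ = ⟨f , e_i h_ν⟩ = Σ_{μ ⊢ i} [h_μ]e_i · [m_{μ ∪ ν}] f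
ePerp : ℕ → SF → SF
ePerp i f ν = sumℤ (map (λ μ → eh i μ * f (sortP (μ ++ ν))) (partitions i))

-- RM_a^{(1)} = Σ_{i ≥ 0} (-1)^i m_(a+i) e_i^⊥ .  On the coefficient of m_λ
-- only i ≤ |λ| can contribute (m_(a+i)·g has no terms of degree < a+i).
RM : ℕ → SF → SF
RM a f λ′ = sumℤ (map (λ i → sign i * mulM (a + i) (ePerp i f) λ′) (upTo (suc (sum λ′))))

module Submission where

-- Regard a symmetric function as its coefficient function in the monomial basis. Then
-- [m_ν](m_(k) f) is a sum over the entries l ≥ k of ν of the coefficient of f at ν with l
-- lowered to l - k, and e_i^⊥ can be evaluated through the h-expansion of e_i, whose
-- defining recursion gives e_{n+1}^⊥ = Σ_k (-1)^k e_{n-k}^⊥ h_{k+1}^⊥, where h_j^⊥ adjoins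
-- a part j to the argument. Hence the terms of RM_a^(1) belonging to a fixed entry l of ν
-- combine into Σ_i (-1)^i e_i^⊥ h_{l-a-i}^⊥, the dual of Σ_i (-1)^i e_i h_{M-i} = δ_{M,0},
-- which vanishes unless l = a. So [m_ν] RM_a^(1) f sums, over the entries of ν equal to a,
-- the coefficient of f at ν with that entry removed. For f = m_λ each such entry contributes
-- [ν = λ + (a)], and λ + (a) has n_a(λ) + 1 entries equal to a.

open import Defs
open import Algebra.Properties.CommutativeSemigroup using (interchange; x∙yz≈y∙xz)
open import Data.Bool using (true; false; if_then_else_)
open import Data.Integer using (ℤ; +_; -_; _+_; _-_; _*_)
import Data.Integer.Properties as ℤ
open import Data.List
  using (List; []; _∷_; _++_; map; concat; concatMap; filter; length; upTo; applyUpTo; zipWith)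
import Data.List.Properties as List
open import Data.List.Relation.Binary.Equality.Propositional using (≋⇒≡)
open import Data.List.Relation.Binary.Permutation.Propositional
  using (_↭_; prep; swap; ↭-sym; ↭⇒↭ₛ) renaming (refl to ↭-refl; trans to ↭-trans)
open import Data.List.Relation.Binary.Permutation.Propositional.Properties
  using (All-resp-↭; ++-comm; shift; drop-∷; ↭-length; filter-↭)
open import Data.List.Relation.Unary.All as All using (All; []; _∷_)
open import Data.List.Relation.Unary.All.Properties using (map⁺; applyUpTo⁺₁; concat⁺)
open import Data.List.Relation.Unary.Linked using (Linked; []; [-]; _∷_)
import Data.List.Relation.Unary.Sorted.TotalOrder.Properties as Sorted
open import Data.Nat using (ℕ; zero; suc; _∸_; _≤_; _<_; _≥_; _≤ᵇ_; _≟_; _<?_; z≤n; s≤s)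
import Data.Nat as ℕ
import Data.Nat.Properties as ℕ
open import Data.Nat.ListAction using (sum)
open import Data.Nat.ListAction.Properties using (sum-↭)
open import Data.Product using (_×_; _,_; proj₁; proj₂)
open import Data.Sum using (inj₁; inj₂)
open import Function using (_∘_; id; _⇔_; mk⇔; Equivalence)
import Relation.Binary.Properties.TotalOrder as TotalOrder
open import Relation.Binary.PropositionalEquality
open import Relation.Nullary using (Dec; yes; no; does; ¬_; _because_)
open import Relation.Nullary.Decidable using (dec-true; dec-false; _×-dec_)
open import Relation.Nullary.Reflects using (ofʸ; ofⁿ)
open import Relation.Unary using (Pred; Decidable)

open ≡-Reasoning

private variable
  A B C D : Set
  P Q : Set

-- Finite sums and indicators

∑ : List A → (A → ℤ) → ℤ
∑ xs f = sumℤ (map f xs)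

∑-cong : (xs : List A) {f g : A → ℤ} → (∀ x → f x ≡ g x) → ∑ xs f ≡ ∑ xs g
∑-cong []       e = refl
∑-cong (x ∷ xs) e = cong₂ _+_ (e x) (∑-cong xs e)

∑-congᴬ : {R : A → Set} {xs : List A} {f g : A → ℤ} →
          (∀ {x} → R x → f x ≡ g x) → All R xs → ∑ xs f ≡ ∑ xs g
∑-congᴬ e []         = refl
∑-congᴬ e (rx ∷ rxs) = cong₂ _+_ (e rx) (∑-congᴬ e rxs)

∑-upTo-cong : ∀ n {F G : ℕ → ℤ} → (∀ {i} → i < n → F i ≡ G i) → ∑ (upTo n) F ≡ ∑ (upTo n) G
∑-upTo-cong n e = ∑-congᴬ e (applyUpTo⁺₁ id n id)

∑-++ : (xs ys : List A) (f : A → ℤ) → ∑ (xs ++ ys) f ≡ ∑ xs f + ∑ ys f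
∑-++ []       ys f = sym (ℤ.+-identityˡ _)
∑-++ (x ∷ xs) ys f = trans (cong (_+_ (f x)) (∑-++ xs ys f)) (sym (ℤ.+-assoc (f x) _ _))

∑-map : (xs : List A) (h : A → B) (f : B → ℤ) → ∑ (map h xs) f ≡ ∑ xs (f ∘ h)
∑-map []       h f = refl
∑-map (x ∷ xs) h f = cong (_+_ (f (h x))) (∑-map xs h f)

∑-concat : (xss : List (List A)) (f : A → ℤ) → ∑ (concat xss) f ≡ ∑ xss (λ xs → ∑ xs f)
∑-concat []         f = refl
∑-concat (xs ∷ xss) f = trans (∑-++ xs (concat xss) f) (cong (_+_ (∑ xs f)) (∑-concat xss f))

∑-concatMap : (xs : List A) (g : A → List B) (f : B → ℤ) →
              ∑ (concatMap g xs) f ≡ ∑ xs (λ x → ∑ (g x) f)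
∑-concatMap xs g f = trans (∑-concat (map g xs) f) (∑-map xs g (λ ys → ∑ ys f))

∑-+ : (xs : List A) (f g : A → ℤ) → ∑ xs (λ x → f x + g x) ≡ ∑ xs f + ∑ xs g
∑-+ []       f g = refl
∑-+ (x ∷ xs) f g = trans (cong (_+_ (f x + g x)) (∑-+ xs f g)) (interchange ℤ.+-commutativeSemigroup (f x) (g x) _ _)

∑-*ˡ : (xs : List A) (c : ℤ) (f : A → ℤ) → c * ∑ xs f ≡ ∑ xs (λ x → c * f x)
∑-*ˡ []       c f = ℤ.*-zeroʳ c
∑-*ˡ (x ∷ xs) c f = trans (ℤ.*-distribˡ-+ c (f x) _) (cong (_+_ (c * f x)) (∑-*ˡ xs c f))

∑-*ʳ : (xs : List A) (c : ℤ) (f : A → ℤ) → ∑ xs f * c ≡ ∑ xs (λ x → f x * c)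
∑-*ʳ xs c f = trans (ℤ.*-comm _ c) (trans (∑-*ˡ xs c f) (∑-cong xs (λ x → ℤ.*-comm c (f x))))

∑-zero : (xs : List A) → ∑ xs (λ _ → + 0) ≡ + 0
∑-zero []       = refl
∑-zero (x ∷ xs) = trans (ℤ.+-identityˡ _) (∑-zero xs)

∑-comm : (xs : List A) (ys : List B) (F : A → B → ℤ) →
         ∑ xs (λ x → ∑ ys (F x)) ≡ ∑ ys (λ y → ∑ xs (λ x → F x y))
∑-comm []       ys F = sym (∑-zero ys)
∑-comm (x ∷ xs) ys F = trans (cong (_+_ (∑ ys (F x))) (∑-comm xs ys F)) (sym (∑-+ ys (F x) _))

∑-applyUpTo-suc : ∀ n (F : ℕ → ℤ) → ∑ (applyUpTo suc n) F ≡ ∑ (upTo n) (F ∘ suc)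
∑-applyUpTo-suc n F = trans (cong (λ ks → ∑ ks F) (sym (List.map-upTo suc n))) (∑-map (upTo n) suc F)

∑-upTo-suc : ∀ n (F : ℕ → ℤ) → ∑ (upTo (suc n)) F ≡ F 0 + ∑ (upTo n) (F ∘ suc)
∑-upTo-suc n F = cong (_+_ (F 0)) (∑-applyUpTo-suc n F)

∑-upTo-∷ʳ : ∀ n (F : ℕ → ℤ) → ∑ (upTo (suc n)) F ≡ ∑ (upTo n) F + F n
∑-upTo-∷ʳ n F = begin
  ∑ (upTo (suc n)) F                    ≡⟨ cong (λ ks → ∑ ks F) (sym (List.upTo-∷ʳ n)) ⟩
  ∑ (upTo n Data.List.∷ʳ n) F           ≡⟨ ∑-++ (upTo n) (n ∷ []) F ⟩
  ∑ (upTo n) F + (F n + + 0)            ≡⟨ cong (_+_ (∑ (upTo n) F)) (ℤ.+-identityʳ (F n)) ⟩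
  ∑ (upTo n) F + F n                    ∎

∑-upTo-reverse : ∀ n (F : ℕ → ℤ) → ∑ (upTo (suc n)) (λ k → F (n ∸ k)) ≡ ∑ (upTo (suc n)) F
∑-upTo-reverse zero    F = refl
∑-upTo-reverse (suc n) F = begin
  ∑ (upTo (suc (suc n))) (λ k → F (suc n ∸ k))  ≡⟨ ∑-upTo-suc (suc n) (λ k → F (suc n ∸ k)) ⟩
  F (suc n) + ∑ (upTo (suc n)) (λ k → F (n ∸ k)) ≡⟨ cong (_+_ (F (suc n))) (∑-upTo-reverse n F) ⟩
  F (suc n) + ∑ (upTo (suc n)) F                 ≡⟨ ℤ.+-comm (F (suc n)) _ ⟩
  ∑ (upTo (suc n)) F + F (suc n)                 ≡⟨ sym (∑-upTo-∷ʳ (suc n) F) ⟩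
  ∑ (upTo (suc (suc n))) F                       ∎

χ : Dec P → ℤ
χ P? = if does P? then + 1 else + 0

χ-yes : (P? : Dec P) → P → χ P? ≡ + 1
χ-yes P? p rewrite dec-true P? p = refl

χ-no : (P? : Dec P) → ¬ P → χ P? ≡ + 0
χ-no P? ¬p rewrite dec-false P? ¬p = refl

χ-× : (P? : Dec P) (Q? : Dec Q) → χ (P? ×-dec Q?) ≡ χ P? * χ Q?
χ-× (true  because _) Q? = sym (ℤ.*-identityˡ (χ Q?))
χ-× (false because _) Q? = refl

χ-cong : (P? : Dec P) (Q? : Dec Q) → P ⇔ Q → χ P? ≡ χ Q?
χ-cong (yes p) Q? P⇔Q = sym (χ-yes Q? (Equivalence.to P⇔Q p))
χ-cong (no ¬p) Q? P⇔Q = sym (χ-no Q? (¬p ∘ Equivalence.from P⇔Q))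

χ-guard : (P? : Dec P) {x y : ℤ} → (P → x ≡ y) → χ P? * x ≡ χ P? * y
χ-guard (yes p) e = cong (+ 1 *_) (e p)
χ-guard (no _)  e = refl

χ-guardʳ : (P? : Dec P) {x y : ℤ} → (P → x ≡ y) → x * χ P? ≡ y * χ P?
χ-guardʳ (yes p) e = cong (_* + 1) (e p)
χ-guardʳ (no _)  {x} {y} e = trans (ℤ.*-zeroʳ x) (sym (ℤ.*-zeroʳ y))

χ-∷ : ∀ x xs y ys → χ ((x ∷ xs) ≟L (y ∷ ys)) ≡ χ (x ≟ y) * χ (xs ≟L ys)
χ-∷ x xs y ys = χ-× (x ≟ y) (xs ≟L ys)

χ-sym : ∀ x y → χ (x ≟ y) ≡ χ (y ≟ x)
χ-sym x y = χ-cong (x ≟ y) (y ≟ x) (mk⇔ sym sym)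

length-filter : {R : Pred A _} (R? : Decidable R) (xs : List A) →
                + length (filter R? xs) ≡ ∑ xs (χ ∘ R?)
length-filter R? []       = refl
length-filter R? (x ∷ xs) with does (R? x)
... | true  = cong (_+_ (+ 1)) (length-filter R? xs)
... | false = trans (length-filter R? xs) (sym (ℤ.+-identityˡ _))

∑-filter : {R : Pred A _} (R? : Decidable R) (xs : List A) (f : A → ℤ) →
           ∑ (filter R? xs) f ≡ ∑ xs (λ x → χ (R? x) * f x)
∑-filter R? []       f = refl
∑-filter R? (x ∷ xs) f with does (R? x)
... | true  = cong₂ _+_ (sym (ℤ.*-identityˡ (f x))) (∑-filter R? xs f)
... | false = trans (∑-filter R? xs f) (sym (ℤ.+-identityˡ _))

∑-upTo-select-out : ∀ n y (K : ℕ → ℤ) → n ≤ y → ∑ (upTo n) (λ i → χ (y ≟ i) * K i) ≡ + 0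
∑-upTo-select-out zero    y K n≤y = refl
∑-upTo-select-out (suc n) y K n<y = begin
  ∑ (upTo (suc n)) (λ i → χ (y ≟ i) * K i)        ≡⟨ ∑-upTo-∷ʳ n _ ⟩
  ∑ (upTo n) (λ i → χ (y ≟ i) * K i) + χ (y ≟ n) * K n
    ≡⟨ cong₂ _+_ (∑-upTo-select-out n y K (ℕ.<⇒≤ n<y))
                 (cong (_* K n) (χ-no (y ≟ n) (ℕ.>⇒≢ n<y))) ⟩
  + 0                                             ∎

∑-upTo-select-in : ∀ n y (K : ℕ → ℤ) → y < n → ∑ (upTo n) (λ i → χ (y ≟ i) * K i) ≡ K y
∑-upTo-select-in (suc n) y K y<1+n with ℕ.m≤n⇒m<n∨m≡n (ℕ.≤-pred y<1+n)
... | inj₁ y<n = begin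
  ∑ (upTo (suc n)) (λ i → χ (y ≟ i) * K i)        ≡⟨ ∑-upTo-∷ʳ n _ ⟩
  ∑ (upTo n) (λ i → χ (y ≟ i) * K i) + χ (y ≟ n) * K n
    ≡⟨ cong₂ _+_ (∑-upTo-select-in n y K y<n) (cong (_* K n) (χ-no (y ≟ n) (ℕ.<⇒≢ y<n))) ⟩
  K y + + 0                                       ≡⟨ ℤ.+-identityʳ (K y) ⟩
  K y                                             ∎
... | inj₂ refl = begin
  ∑ (upTo (suc n)) (λ i → χ (n ≟ i) * K i)        ≡⟨ ∑-upTo-∷ʳ n _ ⟩
  ∑ (upTo n) (λ i → χ (n ≟ i) * K i) + χ (n ≟ n) * K n
    ≡⟨ cong₂ _+_ (∑-upTo-select-out n n K ℕ.≤-refl) (cong (_* K n) (χ-yes (n ≟ n) refl)) ⟩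
  + 0 + + 1 * K n                                 ≡⟨ ℤ.+-identityˡ (+ 1 * K n) ⟩
  + 1 * K n                                       ≡⟨ ℤ.*-identityˡ (K n) ⟩
  K n                                             ∎

∑-upTo-select : ∀ n y (K : ℕ → ℤ) → ∑ (upTo n) (λ i → χ (y ≟ i) * K i) ≡ χ (y <? n) * K y
∑-upTo-select n y K with y <? n
... | yes y<n = begin
  ∑ (upTo n) (λ i → χ (y ≟ i) * K i) ≡⟨ ∑-upTo-select-in n y K y<n ⟩
  K y                                ≡⟨ ℤ.*-identityˡ (K y) ⟨
  + 1 * K y                          ≡⟨ cong (_* K y) (χ-yes (y <? n) y<n) ⟨
  χ (y <? n) * K y                   ∎
... | no  y≮n = begin
  ∑ (upTo n) (λ i → χ (y ≟ i) * K i) ≡⟨ ∑-upTo-select-out n y K (ℕ.≮⇒≥ y≮n) ⟩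
  + 0 * K y                          ≡⟨ cong (_* K y) (χ-no (y <? n) y≮n) ⟨
  χ (y <? n) * K y                   ∎

∑-upTo-truncate : ∀ M N (K : ℕ → ℤ) → M ≤ N → ∑ (upTo N) (λ i → χ (i <? M) * K i) ≡ ∑ (upTo M) K
∑-upTo-truncate M N K M≤N with ℕ.m≤n⇒m<n∨m≡n M≤N
... | inj₂ refl = ∑-upTo-cong M λ {i} i<M → trans (cong (_* K i) (χ-yes (i <? M) i<M)) (ℤ.*-identityˡ (K i))
∑-upTo-truncate M (suc N) K _ | inj₁ M<1+N = begin
  ∑ (upTo (suc N)) (λ i → χ (i <? M) * K i)          ≡⟨ ∑-upTo-∷ʳ N _ ⟩
  ∑ (upTo N) (λ i → χ (i <? M) * K i) + χ (N <? M) * K N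
    ≡⟨ cong₂ _+_ (∑-upTo-truncate M N K (ℕ.≤-pred M<1+N))
                 (cong (_* K N) (χ-no (N <? M) (ℕ.≤⇒≯ (ℕ.≤-pred M<1+N)))) ⟩
  ∑ (upTo M) K + + 0                                  ≡⟨ ℤ.+-identityʳ _ ⟩
  ∑ (upTo M) K                                        ∎

sign-∸ : ∀ n k → k ≤ n → sign n * sign k ≡ sign (n ∸ k)
sign-∸ n       zero    _         = ℤ.*-identityʳ (sign n)
sign-∸ (suc n) (suc k) (s≤s k≤n) = begin
  - sign n * - sign k    ≡⟨ ℤ.neg-distribˡ-* (sign n) (- sign k) ⟨
  - (sign n * - sign k)  ≡⟨ cong -_ (ℤ.neg-distribʳ-* (sign n) (sign k)) ⟨
  - - (sign n * sign k)  ≡⟨ ℤ.neg-involutive (sign n * sign k) ⟩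
  sign n * sign k        ≡⟨ sign-∸ n k k≤n ⟩
  sign (n ∸ k)           ∎

-- Sorting into partitions

Positive : List ℕ → Set
Positive = All (λ x → 1 ≤ x)

Sorted : List ℕ → Set
Sorted = Linked _≥_

sorted-unique : ∀ {xs ys} → Sorted xs → Sorted ys → xs ↭ ys → xs ≡ ys
sorted-unique sxs sys p =
  ≋⇒≡ (Sorted.↗↭↗⇒≋ (TotalOrder.≥-totalOrder ℕ.≤-totalOrder) sxs sys (↭⇒↭ₛ p))

insD-↭ : ∀ x ys → insD x ys ↭ x ∷ ys
insD-↭ x []       = ↭-refl
insD-↭ x (y ∷ ys) with y ≤ᵇ x
... | true  = ↭-refl
... | false = ↭-trans (prep y (insD-↭ x ys)) (swap y x ↭-refl)

insD-sorted-below : ∀ x y ys → x ≤ y → Sorted (y ∷ ys) → Sorted (y ∷ insD x ys)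
insD-sorted-below x y []       x≤y _           = x≤y ∷ [-]
insD-sorted-below x y (z ∷ zs) x≤y (z≤y ∷ szs) with z ≤ᵇ x | ℕ.≤ᵇ-reflects-≤ z x
... | true  | ofʸ z≤x = x≤y ∷ z≤x ∷ szs
... | false | ofⁿ z≰x = z≤y ∷ insD-sorted-below x z zs (ℕ.<⇒≤ (ℕ.≰⇒> z≰x)) szs

insD-sorted : ∀ x ys → Sorted ys → Sorted (insD x ys)
insD-sorted x []       _   = [-]
insD-sorted x (y ∷ ys) sys with y ≤ᵇ x | ℕ.≤ᵇ-reflects-≤ y x
... | true  | ofʸ y≤x = y≤x ∷ sys
... | false | ofⁿ y≰x = insD-sorted-below x y ys (ℕ.<⇒≤ (ℕ.≰⇒> y≰x)) sys

dropZeros : List ℕ → List ℕ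
dropZeros []           = []
dropZeros (zero  ∷ xs) = dropZeros xs
dropZeros (suc x ∷ xs) = suc x ∷ dropZeros xs

dropZeros-positive : ∀ xs → Positive (dropZeros xs)
dropZeros-positive []           = []
dropZeros-positive (zero  ∷ xs) = dropZeros-positive xs
dropZeros-positive (suc x ∷ xs) = s≤s z≤n ∷ dropZeros-positive xs

dropZeros-of-positive : ∀ {xs} → Positive xs → dropZeros xs ≡ xs
dropZeros-of-positive []                     = refl
dropZeros-of-positive {suc x ∷ xs} (_ ∷ pxs) = cong (suc x ∷_) (dropZeros-of-positive pxs)

dropZeros-↭ : ∀ {xs ys} → xs ↭ ys → dropZeros xs ↭ dropZeros ys
dropZeros-↭ ↭-refl                  = ↭-refl
dropZeros-↭ (prep zero p)           = dropZeros-↭ p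
dropZeros-↭ (prep (suc x) p)        = prep (suc x) (dropZeros-↭ p)
dropZeros-↭ (swap zero    zero    p) = dropZeros-↭ p
dropZeros-↭ (swap zero    (suc y) p) = prep (suc y) (dropZeros-↭ p)
dropZeros-↭ (swap (suc x) zero    p) = prep (suc x) (dropZeros-↭ p)
dropZeros-↭ (swap (suc x) (suc y) p) = swap (suc x) (suc y) (dropZeros-↭ p)
dropZeros-↭ (↭-trans p q)           = ↭-trans (dropZeros-↭ p) (dropZeros-↭ q)

sum-dropZeros : ∀ xs → sum (dropZeros xs) ≡ sum xs
sum-dropZeros []           = refl
sum-dropZeros (zero  ∷ xs) = sum-dropZeros xs
sum-dropZeros (suc x ∷ xs) = cong (suc x ℕ.+_) (sum-dropZeros xs)

sortP-↭ : ∀ xs → sortP xs ↭ dropZeros xs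
sortP-↭ []           = ↭-refl
sortP-↭ (zero  ∷ xs) = sortP-↭ xs
sortP-↭ (suc x ∷ xs) = ↭-trans (insD-↭ (suc x) (sortP xs)) (prep (suc x) (sortP-↭ xs))

sortP-sorted : ∀ xs → Sorted (sortP xs)
sortP-sorted []           = []
sortP-sorted (zero  ∷ xs) = sortP-sorted xs
sortP-sorted (suc x ∷ xs) = insD-sorted (suc x) (sortP xs) (sortP-sorted xs)

sortP-isPartition : ∀ xs → IsPartition (sortP xs)
sortP-isPartition xs = All-resp-↭ (↭-sym (sortP-↭ xs)) (dropZeros-positive xs) , sortP-sorted xs

sortP-partition : ∀ {xs} → IsPartition xs → sortP xs ≡ xs
sortP-partition {xs} (pxs , sxs) =
  sorted-unique (sortP-sorted xs) sxs (subst (sortP xs ↭_) (dropZeros-of-positive pxs) (sortP-↭ xs))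

sortP-idem : ∀ xs → sortP (sortP xs) ≡ sortP xs
sortP-idem xs = sortP-partition (sortP-isPartition xs)

sum-sortP : ∀ xs → sum (sortP xs) ≡ sum xs
sum-sortP xs = trans (sum-↭ (sortP-↭ xs)) (sum-dropZeros xs)

sortP-resp-↭ : ∀ {xs ys} → xs ↭ ys → sortP xs ≡ sortP ys
sortP-resp-↭ {xs} {ys} p = sorted-unique (sortP-sorted xs) (sortP-sorted ys)
  (↭-trans (sortP-↭ xs) (↭-trans (dropZeros-↭ p) (↭-sym (sortP-↭ ys))))

sortP-++ˡ : ∀ zs {xs ys} → sortP xs ≡ sortP ys → sortP (zs ++ xs) ≡ sortP (zs ++ ys)
sortP-++ˡ []       e = e
sortP-++ˡ (z ∷ zs) e = cong (λ s → if z ℕ.≡ᵇ 0 then s else insD z s) (sortP-++ˡ zs e)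

sortP-++ʳ : ∀ zs {xs ys} → sortP xs ≡ sortP ys → sortP (xs ++ zs) ≡ sortP (ys ++ zs)
sortP-++ʳ zs {xs} {ys} e = begin
  sortP (xs ++ zs) ≡⟨ sortP-resp-↭ (++-comm xs zs) ⟩
  sortP (zs ++ xs) ≡⟨ sortP-++ˡ zs e ⟩
  sortP (zs ++ ys) ≡⟨ sortP-resp-↭ (++-comm zs ys) ⟩
  sortP (ys ++ zs) ∎

-- Enumerating partitions

infix 4 _⊢_
_⊢_ : List ℕ → ℕ → Set
μ ⊢ n = IsPartition μ × sum μ ≡ n

positive-sum-zero : ∀ {q} → Positive q → sum q ≡ 0 → q ≡ []
positive-sum-zero []      _  = refl
positive-sum-zero (s≤s _ ∷ _) ()

sorted-below-sum : ∀ {q n} → Sorted q → sum q ≡ n → Sorted (n ∷ q)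
sorted-below-sum {[]}    _   _ = [-]
sorted-below-sum {x ∷ q} sxq e = subst (x ≤_) e (ℕ.m≤m+n x (sum q)) ∷ sxq

-- Sorted (m ∷ q) says that no part of q exceeds m, the bound on parts in parts fuel n m.
parts-select : ∀ fuel n m q (g : List ℕ → ℤ) →
               Positive q → Sorted (m ∷ q) → sum q ≡ n → n ≤ fuel →
               ∑ (parts fuel n m) (λ μ → χ (q ≟L μ) * g μ) ≡ g q
parts-select fuel zero m q g pq _ e _ rewrite positive-sum-zero pq e =
  trans (ℤ.+-identityʳ _) (ℤ.*-identityˡ (g []))
parts-select zero (suc n) m q g _ _ _ ()
parts-select (suc fuel) (suc n) m [] g _ _ () _
parts-select (suc fuel) (suc n) m (suc y ∷ q) g (_ ∷ pq) (y<m ∷ sq) e (s≤s n≤fuel) = begin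
  ∑ (concatMap (λ k → map (k ∷_) (rest k)) (applyUpTo suc N)) G
    ≡⟨ ∑-concatMap (applyUpTo suc N) (λ k → map (k ∷_) (rest k)) G ⟩
  ∑ (applyUpTo suc N) (λ k → ∑ (map (k ∷_) (rest k)) G)
    ≡⟨ ∑-cong (applyUpTo suc N) head-split ⟩
  ∑ (applyUpTo suc N) (λ k → χ (suc y ≟ k) * H k)
    ≡⟨ ∑-applyUpTo-suc N _ ⟩
  ∑ (upTo N) (λ i → χ (y ≟ i) * H (suc i))
    ≡⟨ ∑-upTo-select-in N y (H ∘ suc) (ℕ.⊓-glb y<1+n y<m) ⟩
  H (suc y)
    ≡⟨ parts-select fuel (suc n ∸ suc y) (suc y) q (g ∘ (suc y ∷_)) pq sq e′
                    (ℕ.≤-trans (ℕ.m∸n≤m n y) n≤fuel) ⟩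
  g (suc y ∷ q) ∎
  where
  N = suc n ℕ.⊓ m
  rest : ℕ → List (List ℕ)
  rest k = parts fuel (suc n ∸ k) k
  G : List ℕ → ℤ
  G μ = χ ((suc y ∷ q) ≟L μ) * g μ
  H : ℕ → ℤ
  H k = ∑ (rest k) (λ μ → χ (q ≟L μ) * g (k ∷ μ))
  head-split : ∀ k → ∑ (map (k ∷_) (rest k)) G ≡ χ (suc y ≟ k) * H k
  head-split k = begin
    ∑ (map (k ∷_) (rest k)) G
      ≡⟨ ∑-map (rest k) (k ∷_) G ⟩
    ∑ (rest k) (λ μ → χ ((suc y ∷ q) ≟L (k ∷ μ)) * g (k ∷ μ))
      ≡⟨ ∑-cong (rest k) (λ μ → trans (cong (_* g (k ∷ μ)) (χ-∷ (suc y) q k μ))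
                                       (ℤ.*-assoc (χ (suc y ≟ k)) _ _)) ⟩
    ∑ (rest k) (λ μ → χ (suc y ≟ k) * (χ (q ≟L μ) * g (k ∷ μ)))
      ≡⟨ ∑-*ˡ (rest k) (χ (suc y ≟ k)) _ ⟨
    χ (suc y ≟ k) * H k ∎
  y<1+n : suc y ≤ suc n
  y<1+n = subst (suc y ≤_) e (ℕ.m≤m+n (suc y) (sum q))
  e′ : sum q ≡ suc n ∸ suc y
  e′ = sym (trans (cong (_∸ suc y) (sym e)) (ℕ.m+n∸m≡n (suc y) (sum q)))

partitions-select : ∀ {n q} (g : List ℕ → ℤ) → q ⊢ n →
                    ∑ (partitions n) (λ μ → χ (q ≟L μ) * g μ) ≡ g q
partitions-select {n} {q} g ((pq , sq) , e) = parts-select n n n q g pq (sorted-below-sum sq e) e ℕ.≤-refl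

-- Multiplication by m_(k)

χ-insD-[] : ∀ x ys → χ (insD x ys ≟L []) ≡ + 0
χ-insD-[] x []       = refl
χ-insD-[] x (y ∷ ys) with y ≤ᵇ x
... | true  = refl
... | false = refl

χ-insD-[-] : ∀ x ys z → χ (insD x ys ≟L (z ∷ [])) ≡ χ (z ≟ x) * χ (ys ≟L [])
χ-insD-[-] x []       z = trans (χ-∷ x [] z []) (cong (_* + 1) (χ-sym x z))
χ-insD-[-] x (y ∷ ys) z with y ≤ᵇ x
... | true  = trans (χ-∷ x (y ∷ ys) z []) (cong (_* + 0) (χ-sym x z))
... | false = begin
  χ ((y ∷ insD x ys) ≟L (z ∷ []))    ≡⟨ χ-∷ y (insD x ys) z [] ⟩
  χ (y ≟ z) * χ (insD x ys ≟L [])    ≡⟨ cong (χ (y ≟ z) *_) (χ-insD-[] x ys) ⟩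
  χ (y ≟ z) * + 0                    ≡⟨ ℤ.*-zeroʳ (χ (y ≟ z)) ⟩
  + 0                                ≡⟨ ℤ.*-zeroʳ (χ (z ≟ x)) ⟨
  χ (z ≟ x) * + 0                    ∎

picks : List ℕ → List (ℕ × List ℕ)
picks []       = []
picks (l ∷ ls) = (l , ls) ∷ map (λ p → proj₁ p , l ∷ proj₂ p) (picks ls)

IsPick : List ℕ → ℕ × List ℕ → Set
IsPick ν p = proj₁ p ∷ proj₂ p ↭ ν

picks-isPick : ∀ ν → All (IsPick ν) (picks ν)
picks-isPick []       = []
picks-isPick (l ∷ ls) =
  ↭-refl ∷ map⁺ (All.map (λ {p} → ↭-trans (swap (proj₁ p) l ↭-refl) ∘ prep l) (picks-isPick ls))

part≤sum : ∀ {ν p} → IsPick ν p → proj₁ p ≤ sum ν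
part≤sum {p = l , r} pick = subst (l ≤_) (sum-↭ pick) (ℕ.m≤m+n l (sum r))

∑-picks-proj₁ : ∀ ν (h : ℕ → ℤ) → ∑ (picks ν) (h ∘ proj₁) ≡ ∑ ν h
∑-picks-proj₁ []       h = refl
∑-picks-proj₁ (l ∷ ls) h =
  cong (_+_ (h l)) (trans (∑-map (picks ls) (λ p → proj₁ p , l ∷ proj₂ p) (h ∘ proj₁))
                          (∑-picks-proj₁ ls h))

∑-box-zero : ∀ ls (H : List ℕ → ℤ) →
             ∑ (box ls) (λ β → χ (sortP β ≟L []) * H (zipWith _∸_ ls β)) ≡ H ls
∑-box-zero []       H = trans (ℤ.+-identityʳ _) (ℤ.*-identityˡ (H []))
∑-box-zero (l ∷ ls) H = begin
  ∑ (concatMap (λ j → map (j ∷_) (box ls)) (upTo (suc l))) T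
    ≡⟨ ∑-concatMap (upTo (suc l)) (λ j → map (j ∷_) (box ls)) T ⟩
  ∑ (upTo (suc l)) (λ j → ∑ (map (j ∷_) (box ls)) T)
    ≡⟨ ∑-upTo-suc l (λ j → ∑ (map (j ∷_) (box ls)) T) ⟩
  ∑ (map (0 ∷_) (box ls)) T + ∑ (upTo l) (λ i → ∑ (map (suc i ∷_) (box ls)) T)
    ≡⟨ cong₂ _+_ (trans (∑-map (box ls) (0 ∷_) T) (∑-box-zero ls (H ∘ (l ∷_))))
                 (trans (∑-cong (upTo l) nonzero-head) (∑-zero (upTo l))) ⟩
  H (l ∷ ls) + + 0
    ≡⟨ ℤ.+-identityʳ _ ⟩
  H (l ∷ ls) ∎
  where
  T : List ℕ → ℤ
  T β = χ (sortP β ≟L []) * H (zipWith _∸_ (l ∷ ls) β)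
  nonzero-head : ∀ i → ∑ (map (suc i ∷_) (box ls)) T ≡ + 0
  nonzero-head i = begin
    ∑ (map (suc i ∷_) (box ls)) T
      ≡⟨ ∑-map (box ls) (suc i ∷_) T ⟩
    ∑ (box ls) (λ β → χ (insD (suc i) (sortP β) ≟L []) * H (l ∸ suc i ∷ zipWith _∸_ ls β))
      ≡⟨ ∑-cong (box ls) (λ β → cong (_* H (l ∸ suc i ∷ zipWith _∸_ ls β))
                                     (χ-insD-[] (suc i) (sortP β))) ⟩
    ∑ (box ls) (λ _ → + 0)
      ≡⟨ ∑-zero (box ls) ⟩
    + 0 ∎

∑-box-singleton : ∀ k ν (g : List ℕ → ℤ) →
  ∑ (box ν) (λ α → χ (sortP α ≟L (suc k ∷ [])) * g (sortP (zipWith _∸_ ν α)))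
  ≡ ∑ (picks ν) (λ p → χ (k <? proj₁ p) * g (sortP (proj₁ p ∸ suc k ∷ proj₂ p)))
∑-box-singleton k []       g = ℤ.+-identityʳ _
∑-box-singleton k (l ∷ ls) g = begin
  ∑ (concatMap (λ j → map (j ∷_) (box ls)) (upTo (suc l))) T
    ≡⟨ ∑-concatMap (upTo (suc l)) (λ j → map (j ∷_) (box ls)) T ⟩
  ∑ (upTo (suc l)) (λ j → ∑ (map (j ∷_) (box ls)) T)
    ≡⟨ ∑-upTo-suc l (λ j → ∑ (map (j ∷_) (box ls)) T) ⟩
  ∑ (map (0 ∷_) (box ls)) T + ∑ (upTo l) (λ i → ∑ (map (suc i ∷_) (box ls)) T)
    ≡⟨ cong₂ _+_ (trans (∑-map (box ls) (0 ∷_) T) (∑-box-singleton k ls (g ∘ insertPart l)))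
                 (trans (∑-cong (upTo l) nonzero-head) (∑-upTo-select l k (λ i → g (sortP (l ∸ suc i ∷ ls))))) ⟩
  ∑ (picks ls) (λ p → χ (k <? proj₁ p) * g (sortP (l ∷ proj₁ p ∸ suc k ∷ proj₂ p))) + here
    ≡⟨ ℤ.+-comm _ here ⟩
  here + ∑ (picks ls) (λ p → χ (k <? proj₁ p) * g (sortP (l ∷ proj₁ p ∸ suc k ∷ proj₂ p)))
    ≡⟨ cong (_+_ here) (∑-cong (picks ls) (λ p → cong (λ s → χ (k <? proj₁ p) * g s)
                                          (sortP-resp-↭ (swap l (proj₁ p ∸ suc k) (↭-refl {xs = proj₂ p}))))) ⟩
  here + ∑ (picks ls) (λ p → χ (k <? proj₁ p) * g (sortP (proj₁ p ∸ suc k ∷ l ∷ proj₂ p)))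
    ≡⟨ cong (_+_ here) (∑-map (picks ls) (λ p → proj₁ p , l ∷ proj₂ p) _) ⟨
  ∑ (picks (l ∷ ls)) (λ p → χ (k <? proj₁ p) * g (sortP (proj₁ p ∸ suc k ∷ proj₂ p))) ∎
  where
  -- sortP (x ∷ xs) unfolds to insertPart x (sortP xs).
  insertPart : ℕ → List ℕ → List ℕ
  insertPart x s = if x ℕ.≡ᵇ 0 then s else insD x s
  here : ℤ
  here = χ (k <? l) * g (sortP (l ∸ suc k ∷ ls))
  T : List ℕ → ℤ
  T α = χ (sortP α ≟L (suc k ∷ [])) * g (sortP (zipWith _∸_ (l ∷ ls) α))
  nonzero-head : ∀ i → ∑ (map (suc i ∷_) (box ls)) T ≡ χ (k ≟ i) * g (sortP (l ∸ suc i ∷ ls))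
  nonzero-head i = begin
    ∑ (map (suc i ∷_) (box ls)) T
      ≡⟨ ∑-map (box ls) (suc i ∷_) T ⟩
    ∑ (box ls) (λ β → χ (insD (suc i) (sortP β) ≟L (suc k ∷ [])) * G β)
      ≡⟨ ∑-cong (box ls) (λ β → trans (cong (_* G β) (χ-insD-[-] (suc i) (sortP β) (suc k)))
                                      (ℤ.*-assoc (χ (k ≟ i)) _ _)) ⟩
    ∑ (box ls) (λ β → χ (k ≟ i) * (χ (sortP β ≟L []) * G β))
      ≡⟨ ∑-*ˡ (box ls) (χ (k ≟ i)) _ ⟨
    χ (k ≟ i) * ∑ (box ls) (λ β → χ (sortP β ≟L []) * G β)
      ≡⟨ cong (χ (k ≟ i) *_) (∑-box-zero ls (λ z → g (sortP (l ∸ suc i ∷ z)))) ⟩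
    χ (k ≟ i) * g (sortP (l ∸ suc i ∷ ls)) ∎
    where
    G : List ℕ → ℤ
    G β = g (sortP (l ∸ suc i ∷ zipWith _∸_ ls β))

mulM-picks : ∀ k f ν → mulM (suc k) f ν ≡
             ∑ (picks ν) (λ p → χ (k <? proj₁ p) * f (sortP (proj₁ p ∸ suc k ∷ proj₂ p)))
mulM-picks k f ν = begin
  ∑ (partitions n) (λ μ → f μ * + mulCoeff (suc k ∷ []) μ ν)
    ≡⟨ ∑-cong (partitions n) (λ μ → cong (f μ *_) (trans (length-filter _ (box ν))
         (∑-cong (box ν) (λ α → χ-× (sortP α ≟L (suc k ∷ [])) (sortP (zipWith _∸_ ν α) ≟L μ))))) ⟩
  ∑ (partitions n) (λ μ → f μ * ∑ (box ν) (λ α → single α * diff α μ))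
    ≡⟨ ∑-cong (partitions n) (λ μ → ∑-*ˡ (box ν) (f μ) _) ⟩
  ∑ (partitions n) (λ μ → ∑ (box ν) (λ α → f μ * (single α * diff α μ)))
    ≡⟨ ∑-comm (partitions n) (box ν) _ ⟩
  ∑ (box ν) (λ α → ∑ (partitions n) (λ μ → f μ * (single α * diff α μ)))
    ≡⟨ ∑-cong (box ν) (λ α → trans (∑-cong (partitions n) (λ μ → rearrange (f μ) (single α) (diff α μ)))
                                   (sym (∑-*ˡ (partitions n) (single α) _))) ⟩
  ∑ (box ν) (λ α → single α * G (sortP (zipWith _∸_ ν α)))
    ≡⟨ ∑-box-singleton k ν G ⟩
  ∑ (picks ν) (λ p → χ (k <? proj₁ p) * G (sortP (proj₁ p ∸ suc k ∷ proj₂ p)))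
    ≡⟨ ∑-congᴬ collapse (picks-isPick ν) ⟩
  ∑ (picks ν) (λ p → χ (k <? proj₁ p) * f (sortP (proj₁ p ∸ suc k ∷ proj₂ p))) ∎
  where
  n = sum ν ∸ suc k
  single : List ℕ → ℤ
  single α = χ (sortP α ≟L (suc k ∷ []))
  diff : List ℕ → List ℕ → ℤ
  diff α μ = χ (sortP (zipWith _∸_ ν α) ≟L μ)
  G : List ℕ → ℤ
  G s = ∑ (partitions n) (λ μ → χ (s ≟L μ) * f μ)
  rearrange : ∀ x a b → x * (a * b) ≡ a * (b * x)
  rearrange x a b = trans (ℤ.*-comm x (a * b)) (ℤ.*-assoc a b x)
  collapse : ∀ {p} → IsPick ν p →
             χ (k <? proj₁ p) * G (sortP (proj₁ p ∸ suc k ∷ proj₂ p))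
             ≡ χ (k <? proj₁ p) * f (sortP (proj₁ p ∸ suc k ∷ proj₂ p))
  collapse {l , r} pick = χ-guard (k <? l) λ k<l →
    partitions-select f (sortP-isPartition (l ∸ suc k ∷ r) ,
      trans (sum-sortP (l ∸ suc k ∷ r)) (trans (sym (ℕ.+-∸-comm (sum r) k<l)) (cong (_∸ suc k) (sum-↭ pick))))

-- The h-expansion of e_n and the operators e_i^⊥

zipWith-map-map : (h : B → C → D) (f : A → B) (g : A → C) (xs : List A) →
                  zipWith h (map f xs) (map g xs) ≡ map (λ x → h (f x) (g x)) xs
zipWith-map-map h f g []       = refl
zipWith-map-map h f g (x ∷ xs) = cong (h (f x) (g x) ∷_) (zipWith-map-map h f g xs)

signedHMul : ℕ → List (ℤ × List ℕ) → List (ℤ × List ℕ)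
signedHMul r = map (λ p → sign (r ∸ 1) * proj₁ p , sortP (r ∷ proj₂ p))

es-eExp : ∀ n → es n ≡ map (λ k → eExp (n ∸ k)) (upTo (suc n))
es-eExp zero    = refl
es-eExp (suc n) = cong (eExp (suc n) ∷_) (begin
  es n                                         ≡⟨ es-eExp n ⟩
  map (λ k → eExp (n ∸ k)) (upTo (suc n))      ≡⟨ List.map-upTo (λ k → eExp (n ∸ k)) (suc n) ⟩
  applyUpTo (λ k → eExp (n ∸ k)) (suc n)       ≡⟨ List.map-applyUpTo suc (λ k → eExp (suc n ∸ k)) (suc n) ⟨
  map (λ k → eExp (suc n ∸ k)) (applyUpTo suc (suc n)) ∎)

eExp-suc : ∀ n → eExp (suc n) ≡ concat (map (λ k → signedHMul (suc k) (eExp (n ∸ k))) (upTo (suc n)))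
eExp-suc n = cong concat (begin
  zipWith signedHMul (applyUpTo suc (suc n)) (es n)
    ≡⟨ cong₂ (zipWith signedHMul) (sym (List.map-upTo suc (suc n))) (es-eExp n) ⟩
  zipWith signedHMul (map suc (upTo (suc n))) (map (λ k → eExp (n ∸ k)) (upTo (suc n)))
    ≡⟨ zipWith-map-map signedHMul suc (λ k → eExp (n ∸ k)) (upTo (suc n)) ⟩
  map (λ k → signedHMul (suc k) (eExp (n ∸ k))) (upTo (suc n)) ∎)

∑-eExp-suc : ∀ n (h : ℤ × List ℕ → ℤ) → ∑ (eExp (suc n)) h ≡
  ∑ (upTo (suc n)) (λ k → ∑ (eExp (n ∸ k)) (λ p → h (sign k * proj₁ p , sortP (suc k ∷ proj₂ p))))
∑-eExp-suc n h = begin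
  ∑ (eExp (suc n)) h
    ≡⟨ cong (λ ps → ∑ ps h) (eExp-suc n) ⟩
  ∑ (concat (map (λ k → signedHMul (suc k) (eExp (n ∸ k))) (upTo (suc n)))) h
    ≡⟨ ∑-concatMap (upTo (suc n)) (λ k → signedHMul (suc k) (eExp (n ∸ k))) h ⟩
  ∑ (upTo (suc n)) (λ k → ∑ (signedHMul (suc k) (eExp (n ∸ k))) h)
    ≡⟨ ∑-cong (upTo (suc n)) (λ k → ∑-map (eExp (n ∸ k)) _ h) ⟩
  ∑ (upTo (suc n)) (λ k → ∑ (eExp (n ∸ k)) (λ p → h (sign k * proj₁ p , sortP (suc k ∷ proj₂ p)))) ∎

signedHMul-⊢ : ∀ r {n} {ps : List (ℤ × List ℕ)} →
               All (λ p → proj₂ p ⊢ n) ps → All (λ p → proj₂ p ⊢ r ℕ.+ n) (signedHMul r ps)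
signedHMul-⊢ r = map⁺ ∘ All.map λ {p} μ⊢n →
  sortP-isPartition (r ∷ proj₂ p) , trans (sum-sortP (r ∷ proj₂ p)) (cong (r ℕ.+_) (proj₂ μ⊢n))

eExp-⊢ : ∀ n → All (λ p → proj₂ p ⊢ n) (eExp n)
eExp-⊢ n = bounded n n ℕ.≤-refl
  where
  bounded : ∀ fuel m → m ≤ fuel → All (λ p → proj₂ p ⊢ m) (eExp m)
  bounded _          zero    _           = (([] , []) , refl) ∷ []
  bounded (suc fuel) (suc m) (s≤s m≤fuel) =
    subst (All (λ p → proj₂ p ⊢ suc m)) (sym (eExp-suc m))
      (concat⁺ (map⁺ (applyUpTo⁺₁ id (suc m) λ {k} k<1+m →
        subst (λ d → All (λ p → proj₂ p ⊢ d) (signedHMul (suc k) (eExp (m ∸ k))))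
              (cong suc (ℕ.m+[n∸m]≡n (ℕ.≤-pred k<1+m)))
              (signedHMul-⊢ (suc k) (bounded fuel (m ∸ k) (ℕ.≤-trans (ℕ.m∸n≤m m k) m≤fuel))))))

ePerpExp : ℕ → SF → SF
ePerpExp i f Y = ∑ (eExp i) (λ p → proj₁ p * f (sortP (proj₂ p ++ Y)))

ePerp≡ePerpExp : ∀ i f Y → ePerp i f Y ≡ ePerpExp i f Y
ePerp≡ePerpExp i f Y = begin
  ∑ (partitions i) (λ μ → eh i μ * g μ)
    ≡⟨ ∑-cong (partitions i) (λ μ → cong (_* g μ) (∑-filter (λ p → proj₂ p ≟L μ) (eExp i) proj₁)) ⟩
  ∑ (partitions i) (λ μ → ∑ (eExp i) (λ p → χ (proj₂ p ≟L μ) * proj₁ p) * g μ)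
    ≡⟨ ∑-cong (partitions i) (λ μ → ∑-*ʳ (eExp i) (g μ) _) ⟩
  ∑ (partitions i) (λ μ → ∑ (eExp i) (λ p → χ (proj₂ p ≟L μ) * proj₁ p * g μ))
    ≡⟨ ∑-comm (partitions i) (eExp i) _ ⟩
  ∑ (eExp i) (λ p → ∑ (partitions i) (λ μ → χ (proj₂ p ≟L μ) * proj₁ p * g μ))
    ≡⟨ ∑-cong (eExp i) (λ p → trans (∑-cong (partitions i)
                                               (λ μ → rearrange (χ (proj₂ p ≟L μ)) (proj₁ p) (g μ)))
                                    (sym (∑-*ˡ (partitions i) (proj₁ p) _))) ⟩
  ∑ (eExp i) (λ p → proj₁ p * ∑ (partitions i) (λ μ → χ (proj₂ p ≟L μ) * g μ))
    ≡⟨ ∑-congᴬ (λ {p} μ⊢i → cong (proj₁ p *_) (partitions-select g μ⊢i)) (eExp-⊢ i) ⟩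
  ∑ (eExp i) (λ p → proj₁ p * g (proj₂ p)) ∎
  where
  g : List ℕ → ℤ
  g μ = f (sortP (μ ++ Y))
  rearrange : ∀ a c x → a * c * x ≡ c * (a * x)
  rearrange a c x = trans (cong (_* x) (ℤ.*-comm a c)) (ℤ.*-assoc c a x)

ePerpExp-cong : ∀ i f {Y Y′} → sortP Y ≡ sortP Y′ → ePerpExp i f Y ≡ ePerpExp i f Y′
ePerpExp-cong i f e = ∑-cong (eExp i) (λ p → cong (λ s → proj₁ p * f s) (sortP-++ˡ (proj₂ p) e))

ePerpExp-suc : ∀ n f X →
  ePerpExp (suc n) f X ≡ ∑ (upTo (suc n)) (λ k → sign k * ePerpExp (n ∸ k) f (suc k ∷ X))
ePerpExp-suc n f X = trans (∑-eExp-suc n (λ p → proj₁ p * f (sortP (proj₂ p ++ X))))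
  (∑-cong (upTo (suc n)) λ k → trans (∑-cong (eExp (n ∸ k)) (λ p → term k (proj₁ p) (proj₂ p)))
                                     (sym (∑-*ˡ (eExp (n ∸ k)) (sign k) _)))
  where
  term : ∀ k c μ → sign k * c * f (sortP (sortP (suc k ∷ μ) ++ X)) ≡ sign k * (c * f (sortP (μ ++ suc k ∷ X)))
  term k c μ = trans (ℤ.*-assoc (sign k) c _) (cong (λ s → sign k * (c * f s)) (begin
    sortP (sortP (suc k ∷ μ) ++ X)
      ≡⟨ sortP-++ʳ X {sortP (suc k ∷ μ)} {suc k ∷ μ} (sortP-idem (suc k ∷ μ)) ⟩
    sortP (suc k ∷ μ ++ X)         ≡⟨ sortP-resp-↭ (shift (suc k) μ X) ⟨
    sortP (μ ++ suc k ∷ X)         ∎))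

-- The operator RM_a^(1)

module _ (f : SF) where

  signedEPerp : ℕ → SF
  signedEPerp i Y = sign i * ePerpExp i f Y

  signedEPerp-suc : ∀ n X →
    signedEPerp (suc n) X ≡ - ∑ (upTo (suc n)) (λ k → signedEPerp (n ∸ k) (suc k ∷ X))
  signedEPerp-suc n X = begin
    - sign n * ePerpExp (suc n) f X
      ≡⟨ ℤ.neg-distribˡ-* (sign n) _ ⟨
    - (sign n * ePerpExp (suc n) f X)
      ≡⟨ cong (λ z → - (sign n * z)) (ePerpExp-suc n f X) ⟩
    - (sign n * ∑ (upTo (suc n)) (λ k → sign k * ePerpExp (n ∸ k) f (suc k ∷ X)))
      ≡⟨ cong -_ (trans (∑-*ˡ (upTo (suc n)) (sign n) _) (∑-upTo-cong (suc n) λ {k} k<1+n →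
           trans (sym (ℤ.*-assoc (sign n) (sign k) _))
                 (cong (_* ePerpExp (n ∸ k) f (suc k ∷ X)) (sign-∸ n k (ℕ.≤-pred k<1+n))))) ⟩
    - ∑ (upTo (suc n)) (λ k → signedEPerp (n ∸ k) (suc k ∷ X)) ∎

  ∑-signedEPerp-h : ∀ M r → ∑ (upTo (suc M)) (λ i → signedEPerp i (M ∸ i ∷ r)) ≡ χ (0 ≟ M) * f (sortP r)
  ∑-signedEPerp-h zero    r =
    trans (ℤ.+-identityʳ _) (cong (+ 1 *_) (trans (ℤ.+-identityʳ _) (ℤ.*-identityˡ _)))
  ∑-signedEPerp-h (suc n) r = begin
    ∑ (upTo (suc (suc n))) (λ i → signedEPerp i (suc n ∸ i ∷ r))
      ≡⟨ ∑-upTo-∷ʳ (suc n) (λ i → signedEPerp i (suc n ∸ i ∷ r)) ⟩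
    S + signedEPerp (suc n) (suc n ∸ suc n ∷ r)
      ≡⟨ cong (λ j → S + signedEPerp (suc n) (j ∷ r)) (ℕ.n∸n≡0 n) ⟩
    S + signedEPerp (suc n) (0 ∷ r)
      ≡⟨ cong (λ z → S + sign (suc n) * z) (ePerpExp-cong (suc n) f {0 ∷ r} {r} refl) ⟩
    S + signedEPerp (suc n) r
      ≡⟨ cong (_+_ S) (signedEPerp-suc n r) ⟩
    S - ∑ (upTo (suc n)) (λ k → signedEPerp (n ∸ k) (suc k ∷ r))
      ≡⟨ cong (λ z → S - z) (∑-upTo-cong (suc n) λ {k} k<1+n →
           cong (λ j → signedEPerp (n ∸ k) (j ∷ r)) (suc-k k (ℕ.≤-pred k<1+n))) ⟩
    S - ∑ (upTo (suc n)) (λ k → G (n ∸ k))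
      ≡⟨ cong (λ z → S - z) (∑-upTo-reverse n G) ⟩
    S - S
      ≡⟨ ℤ.+-inverseʳ S ⟩
    + 0 ∎
    where
    G : ℕ → ℤ
    G i = signedEPerp i (suc n ∸ i ∷ r)
    S : ℤ
    S = ∑ (upTo (suc n)) G
    suc-k : ∀ k → k ≤ n → suc k ≡ suc n ∸ (n ∸ k)
    suc-k k k≤n = sym (trans (ℕ.+-∸-assoc 1 (ℕ.m∸n≤m n k)) (cong suc (ℕ.m∸[m∸n]≡n k≤n)))

  ∑-removePart : ∀ a l r S → l ≤ S →
    ∑ (upTo (suc S)) (λ i → χ (a ℕ.+ i <? l) * signedEPerp i (l ∸ suc (a ℕ.+ i) ∷ r))
    ≡ χ (suc a ≟ l) * f (sortP r)
  ∑-removePart a       zero    r S _   = ∑-zero (upTo (suc S))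
  ∑-removePart zero    (suc l) r S l<S =
    trans (∑-upTo-truncate (suc l) (suc S) (λ i → signedEPerp i (l ∸ i ∷ r)) (s≤s (ℕ.<⇒≤ l<S)))
          (∑-signedEPerp-h l r)
  ∑-removePart (suc a) (suc l) r S l<S = ∑-removePart a l r S (ℕ.<⇒≤ l<S)

RM-picks : ∀ a f ν → RM (suc a) f ν ≡ ∑ (picks ν) (λ p → χ (suc a ≟ proj₁ p) * f (sortP (proj₂ p)))
RM-picks a f ν = begin
  ∑ (upTo (suc S)) (λ i → sign i * mulM (suc a ℕ.+ i) (ePerp i f) ν)
    ≡⟨ ∑-cong (upTo (suc S)) (λ i → trans (cong (sign i *_) (mulM-picks (a ℕ.+ i) (ePerp i f) ν))
         (trans (∑-*ˡ (picks ν) (sign i) _) (∑-cong (picks ν) (λ p → signed i (proj₁ p) (proj₂ p))))) ⟩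
  ∑ (upTo (suc S)) (λ i → ∑ (picks ν) (T i))
    ≡⟨ ∑-comm (upTo (suc S)) (picks ν) T ⟩
  ∑ (picks ν) (λ p → ∑ (upTo (suc S)) (λ i → T i p))
    ≡⟨ ∑-congᴬ (λ {p} pick → ∑-removePart f a (proj₁ p) (proj₂ p) S (part≤sum pick)) (picks-isPick ν) ⟩
  ∑ (picks ν) (λ p → χ (suc a ≟ proj₁ p) * f (sortP (proj₂ p))) ∎
  where
  S = sum ν
  T : ℕ → ℕ × List ℕ → ℤ
  T i p = χ (a ℕ.+ i <? proj₁ p) * signedEPerp f i (proj₁ p ∸ suc (a ℕ.+ i) ∷ proj₂ p)
  signed : ∀ i l r → sign i * (χ (a ℕ.+ i <? l) * ePerp i f (sortP (l ∸ suc (a ℕ.+ i) ∷ r))) ≡ T i (l , r)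
  signed i l r = begin
    sign i * (χ (a ℕ.+ i <? l) * ePerp i f (sortP Z))
      ≡⟨ cong (λ z → sign i * (χ (a ℕ.+ i <? l) * z))
              (trans (ePerp≡ePerpExp i f (sortP Z)) (ePerpExp-cong i f (sortP-idem Z))) ⟩
    sign i * (χ (a ℕ.+ i <? l) * ePerpExp i f Z)
      ≡⟨ x∙yz≈y∙xz ℤ.*-commutativeSemigroup (sign i) (χ (a ℕ.+ i <? l)) (ePerpExp i f Z) ⟩
    T i (l , r) ∎
    where
    Z = l ∸ suc (a ℕ.+ i) ∷ r

⊕-↭ : ∀ a {λ′} → Positive λ′ → λ′ ⊕ suc a ↭ suc a ∷ λ′
⊕-↭ a {λ′} pλ =
  subst (λ′ ⊕ suc a ↭_) (cong (suc a ∷_) (dropZeros-of-positive pλ)) (sortP-↭ (suc a ∷ λ′))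

nPart-⊕ : ∀ a {λ′} → Positive λ′ → nPart (suc a) (λ′ ⊕ suc a) ≡ suc (nPart (suc a) λ′)
nPart-⊕ a {λ′} pλ = trans (↭-length (filter-↭ (suc a ≟_) (⊕-↭ a pλ)))
                          (cong length (List.filter-accept (suc a ≟_) {x = suc a} refl))

remainder≡⇔⊕≡ : ∀ a {λ′ ν r} → IsPartition λ′ → IsPartition ν → suc a ∷ r ↭ ν →
                sortP r ≡ λ′ ⇔ ν ≡ λ′ ⊕ suc a
remainder≡⇔⊕≡ a {λ′} {ν} {r} pλ pν a∷r↭ν = mk⇔ to from
  where
  to : sortP r ≡ λ′ → ν ≡ λ′ ⊕ suc a
  to e = begin
    ν                  ≡⟨ sortP-partition pν ⟨
    sortP ν            ≡⟨ sortP-resp-↭ a∷r↭ν ⟨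
    sortP (suc a ∷ r)  ≡⟨ sortP-++ˡ (suc a ∷ []) {r} {λ′} (trans e (sym (sortP-partition pλ))) ⟩
    sortP (suc a ∷ λ′) ∎
  from : ν ≡ λ′ ⊕ suc a → sortP r ≡ λ′
  from refl = trans (sortP-resp-↭ (drop-∷ (↭-trans a∷r↭ν (⊕-↭ a (proj₁ pλ))))) (sortP-partition pλ)

∑-picks-mono : ∀ a λ′ ν → IsPartition λ′ → IsPartition ν →
  ∑ (picks ν) (λ p → χ (suc a ≟ proj₁ p) * mono λ′ (sortP (proj₂ p)))
  ≡ + (1 ℕ.+ nPart (suc a) λ′) * mono (λ′ ⊕ suc a) ν
∑-picks-mono a λ′ ν pλ pν = begin
  ∑ (picks ν) (λ p → χ (suc a ≟ proj₁ p) * mono λ′ (sortP (proj₂ p)))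
    ≡⟨ ∑-congᴬ (λ {p} pick↭ν → χ-guard (suc a ≟ proj₁ p) λ { refl →
         χ-cong (sortP (proj₂ p) ≟L λ′) (ν ≟L (λ′ ⊕ suc a)) (remainder≡⇔⊕≡ a pλ pν pick↭ν) })
               (picks-isPick ν) ⟩
  ∑ (picks ν) (λ p → χ (suc a ≟ proj₁ p) * m)
    ≡⟨ ∑-*ʳ (picks ν) m (χ ∘ (suc a ≟_) ∘ proj₁) ⟨
  ∑ (picks ν) (χ ∘ (suc a ≟_) ∘ proj₁) * m
    ≡⟨ cong (_* m) (trans (∑-picks-proj₁ ν (χ ∘ (suc a ≟_))) (sym (length-filter (suc a ≟_) ν))) ⟩
  + nPart (suc a) ν * m
    ≡⟨ χ-guardʳ (ν ≟L (λ′ ⊕ suc a)) {+ nPart (suc a) ν} {+ (1 ℕ.+ nPart (suc a) λ′)}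
                (λ { refl → cong +_ (nPart-⊕ a (proj₁ pλ)) }) ⟩
  + (1 ℕ.+ nPart (suc a) λ′) * m ∎
  where
  m = mono (λ′ ⊕ suc a) ν

mainTheorem7 : (a : ℕ) → 1 ≤ a → (λ′ : List ℕ) → IsPartition λ′ →
    (ν : List ℕ) → IsPartition ν →
    RM a (mono λ′) ν ≡ (+ (1 Data.Nat.+ nPart a λ′)) * mono (λ′ ⊕ a) ν
mainTheorem7 (suc a) (s≤s z≤n) λ′ pλ ν pν = begin
  RM (suc a) (mono λ′) ν
    ≡⟨ RM-picks a (mono λ′) ν ⟩
  ∑ (picks ν) (λ p → χ (suc a ≟ proj₁ p) * mono λ′ (sortP (proj₂ p)))
    ≡⟨ ∑-picks-mono a λ′ ν pλ pν ⟩
  + (1 ℕ.+ nPart (suc a) λ′) * mono (λ′ ⊕ suc a) ν ∎
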